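{- For every integer $a\ge 3$, $$ g(a,a+3,a+4,a+5)=\left(1+\left\lfloor \frac{a+1}{5}\right\rfloor\right)a+2. $$
   Context: For positive integers $a_1,\dots,a_m$ with $\gcd(a_1,\dots,a_m)=1$, the Frobenius number $g(a_1,\dots,a_m)$ is the largest positive integer that cannot be written as $x_1a_1+\cdots+x_ma_m$ with nonnegative integers $x_i$. $\lfloor x\rfloor$ is the floor. -}

module Defs where

open import Data.Nat using (ℕ; _+_; _*_; _<_)
open import Data.List using (List; []; _∷_)
open import Data.Product using (∃; _×_)
open import Relation.Nullary using (¬_)
open import Data.Empty using (⊥)
open import Data.Unit using (⊤)
open import Relation.Binary.PropositionalEquality using (_≡_)

Representable : List ℕ → ℕ → Set
Representable []       n = n ≡ 0
Representable (a ∷ as) n = ∃ λ x → ∃ λ r → Representable as r × n ≡ x * a + r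

IsFrobeniusNumber : List ℕ → ℕ → Set
IsFrobeniusNumber as g = ¬ Representable as g × (∀ n → g < n → Representable as n)

-- Every sum of t of the generators a, a + 3, a + 4, a + 5 is t·a + s, where s is a
-- sum of t "offsets" from {0, 3, 4, 5}; such s lie in [0, 5t] and are never 2, and
-- for t ≥ 1 every value in {0} ∪ [3, 5t] occurs. With k = ⌊(a + 1)/5⌋ we have
-- 5k ≤ a + 1 ≤ 5k + 4, so (k + 1)a + 2 would need k + 1 generators and offset 2
-- (fewer generators leave too large an offset, more overshoot), whereas the next
-- a integers are (k + 1)a + 3 + u with u ≤ 5k + 2, and adding a fills the rest.
module Submission where

open import Defs
open import Data.Nat using (ℕ; zero; suc; _+_; _*_; _/_; _%_; _≤_; _<_; z≤n; s≤s; s≤s⁻¹; NonZero; >-nonZero)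
open import Data.Nat.Properties
open import Algebra.Properties.CommutativeSemigroup +-commutativeSemigroup using (x∙yz≈y∙xz; x∙yz≈yx∙z)
open import Data.Nat.DivMod using (m≡m%n+[m/n]*n; m%n<n; m/n*n≤m)
open import Data.Nat.Tactic.RingSolver using (solve-∀)
open import Data.List using (List; []; _∷_; map)
open import Data.List.Membership.Propositional using (_∈_)
open import Data.List.Membership.Propositional.Properties using (∈-map⁺; ∈-map⁻)
open import Data.List.Relation.Unary.Any using (here; there)
open import Data.Product using (∃₂; _×_; _,_)
open import Data.Empty using (⊥)
open import Relation.Binary using (tri<; tri≈; tri>)
open import Relation.Binary.PropositionalEquality
open import Relation.Nullary using (¬_)
open import Function using (flip)

private variable
  as D : List ℕ
  a b k m n s t u : ℕ

Representable-zero : ∀ as → Representable as 0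
Representable-zero []       = refl
Representable-zero (_ ∷ as) = 0 , 0 , Representable-zero as , refl

Representable-+ : b ∈ as → Representable as n → Representable as (b + n)
Representable-+ {b} (here refl) (x , r , rep , refl) =
  suc x , r , rep , sym (+-assoc b (x * b) r)
Representable-+ {b} (there b∈as) (x , r , rep , refl) =
  x , b + r , Representable-+ b∈as rep , x∙yz≈y∙xz b _ r

Representable-*-+ : ∀ q → b ∈ as → Representable as n → Representable as (q * b + n)
Representable-*-+             zero    b∈as rep = rep
Representable-*-+ {b} {n = n} (suc q) b∈as rep =
  subst (Representable _) (sym (+-assoc b (q * b) n))
    (Representable-+ b∈as (Representable-*-+ q b∈as rep))

Representable-elim : (P : ℕ → Set) → P 0 → (∀ {b m} → b ∈ as → P m → P (b + m)) →
                     Representable as n → P n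
Representable-elim {[]}     P base step refl = base
Representable-elim {a ∷ as} P base step (x , r , rep , refl) = go x
  where
  go : ∀ x → P (x * a + r)
  go zero    = Representable-elim P base (λ b∈as → step (there b∈as)) rep
  go (suc x) = subst P (sym (+-assoc a (x * a) r)) (step (here refl) (go x))

representable-beyond : .{{NonZero b}} → b ∈ as →
                       (∀ i → i < b → Representable as (m + i)) →
                       ∀ n → m ≤ n → Representable as n
representable-beyond {b} {m = m} b∈as run n m≤n with m≤n⇒∃[o]m+o≡n m≤n
... | i , refl = subst (Representable _) shift
                   (Representable-*-+ (i / b) b∈as (run (i % b) (m%n<n i b)))
  where
  open ≡-Reasoning
  shift : i / b * b + (m + i % b) ≡ m + i
  shift = begin
    i / b * b + (m + i % b)  ≡⟨ x∙yz≈y∙xz (i / b * b) m (i % b) ⟩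
    m + (i / b * b + i % b)  ≡⟨ cong (m +_) (+-comm (i / b * b) (i % b)) ⟩
    m + (i % b + i / b * b)  ≡⟨ cong (m +_) (m≡m%n+[m/n]*n i b) ⟨
    m + i                    ∎

data SumOf (D : List ℕ) : ℕ → ℕ → Set where
  []  : SumOf D 0 0
  _∷_ : ∀ {d t s} → d ∈ D → SumOf D t s → SumOf D (suc t) (d + s)

SumOf-≤ : (∀ {d} → d ∈ D → d ≤ m) → SumOf D t s → s ≤ t * m
SumOf-≤ bound []        = z≤n
SumOf-≤ bound (d∈D ∷ σ) = +-mono-≤ (bound d∈D) (SumOf-≤ bound σ)

[a+d]+[t*a+s]≡[1+t]*a+[d+s] : ∀ a d t s → (a + d) + (t * a + s) ≡ suc t * a + (d + s)
[a+d]+[t*a+s]≡[1+t]*a+[d+s] = solve-∀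

SumOf⇒Representable-shifted : SumOf D t s → Representable (map (a +_) D) (t * a + s)
SumOf⇒Representable-shifted                 []                        = Representable-zero _
SumOf⇒Representable-shifted {a = a} (_∷_ {d} {t} {s} d∈D σ) =
  subst (Representable _) ([a+d]+[t*a+s]≡[1+t]*a+[d+s] a d t s)
    (Representable-+ (∈-map⁺ (a +_) d∈D) (SumOf⇒Representable-shifted σ))

Representable-shifted⇒SumOf : Representable (map (a +_) D) n →
                              ∃₂ λ t s → SumOf D t s × n ≡ t * a + s
Representable-shifted⇒SumOf {a} {D} = Representable-elim Decomposed (0 , 0 , [] , refl) step
  where
  Decomposed : ℕ → Set
  Decomposed n = ∃₂ λ t s → SumOf D t s × n ≡ t * a + s
  step : ∀ {b m} → b ∈ map (a +_) D → Decomposed m → Decomposed (b + m)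
  step b∈ (t , s , σ , refl) with ∈-map⁻ (a +_) b∈
  ... | d , d∈D , refl = suc t , d + s , d∈D ∷ σ , [a+d]+[t*a+s]≡[1+t]*a+[d+s] a d t s

offsets : List ℕ
offsets = 0 ∷ 3 ∷ 4 ∷ 5 ∷ []

offset≤5 : ∀ {d} → d ∈ offsets → d ≤ 5
offset≤5 (here refl)                         = z≤n
offset≤5 (there (here refl))                 = m≤m+n 3 2
offset≤5 (there (there (here refl)))         = m≤m+n 4 1
offset≤5 (there (there (there (here refl)))) = ≤-refl

¬SumOf-offsets-2 : ¬ SumOf offsets t 2
¬SumOf-offsets-2 σ = go σ refl
  where
  go : SumOf offsets t s → s ≡ 2 → ⊥
  go (here refl                         ∷ σ) = go σ
  go (there (here refl)                 ∷ _) ()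
  go (there (there (here refl))         ∷ _) ()
  go (there (there (there (here refl))) ∷ _) ()

SumOf-offsets-3+ : ∀ t u → u ≤ 2 + t * 5 → SumOf offsets (suc t) (3 + u)
SumOf-offsets-3+ zero    0 _ = there (here refl) ∷ []
SumOf-offsets-3+ zero    1 _ = there (there (here refl)) ∷ []
SumOf-offsets-3+ zero    2 _ = there (there (there (here refl))) ∷ []
SumOf-offsets-3+ zero    (suc (suc (suc _))) (s≤s (s≤s ()))
SumOf-offsets-3+ (suc t) 0 _ = here refl ∷ SumOf-offsets-3+ t 0 z≤n
SumOf-offsets-3+ (suc t) 1 _ = here refl ∷ SumOf-offsets-3+ t 1 (s≤s z≤n)
SumOf-offsets-3+ (suc t) 2 _ = here refl ∷ SumOf-offsets-3+ t 2 (s≤s (s≤s z≤n))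
SumOf-offsets-3+ (suc t) 3 _ = there (here refl) ∷ SumOf-offsets-3+ t 0 z≤n
SumOf-offsets-3+ (suc t) 4 _ = there (here refl) ∷ SumOf-offsets-3+ t 1 (s≤s z≤n)
SumOf-offsets-3+ (suc t) (suc (suc (suc (suc (suc v))))) (s≤s (s≤s (s≤s (s≤s (s≤s v≤))))) =
  there (there (there (here refl))) ∷ SumOf-offsets-3+ t v v≤

m<n+[m/n]*n : ∀ m n .{{_ : NonZero n}} → m < n + m / n * n
m<n+[m/n]*n m n = begin-strict
  m                  ≡⟨ m≡m%n+[m/n]*n m n ⟩
  m % n + m / n * n  <⟨ +-monoˡ-< (m / n * n) (m%n<n m n) ⟩
  n + m / n * n      ∎
  where open ≤-Reasoning

a≤3+[a+1]/5*5 : ∀ a → a ≤ 3 + (a + 1) / 5 * 5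
a≤3+[a+1]/5*5 a = +-cancelʳ-≤ 2 a (3 + (a + 1) / 5 * 5) (begin
  a + 2                      ≡⟨ +-suc a 1 ⟩
  suc (a + 1)                ≤⟨ m<n+[m/n]*n (a + 1) 5 ⟩
  5 + (a + 1) / 5 * 5        ≡⟨ +-comm 2 (3 + (a + 1) / 5 * 5) ⟩
  3 + (a + 1) / 5 * 5 + 2    ∎)
  where open ≤-Reasoning

frobenius-gap : 3 ≤ a → k * 5 ≤ a + 1 → SumOf offsets t s → (1 + k) * a + 2 ≢ t * a + s
frobenius-gap {a} {k} {t} {s} 3≤a k*5≤a+1 σ eq with <-cmp t (suc k)
... | tri< t<1+k _ _ = <-irrefl (sym eq) (too-few (s≤s⁻¹ t<1+k))
  where
  open ≤-Reasoning
  too-few : t ≤ k → t * a + s < (1 + k) * a + 2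
  too-few t≤k = begin-strict
    t * a + s        ≤⟨ +-mono-≤ (*-monoˡ-≤ a t≤k) (≤-trans (SumOf-≤ offset≤5 σ) (*-monoˡ-≤ 5 t≤k)) ⟩
    k * a + k * 5    ≤⟨ +-monoʳ-≤ (k * a) k*5≤a+1 ⟩
    k * a + (a + 1)  <⟨ +-monoʳ-< (k * a) (+-monoʳ-< a ≤-refl) ⟩
    k * a + (a + 2)  ≡⟨ x∙yz≈yx∙z (k * a) a 2 ⟩
    (1 + k) * a + 2  ∎
... | tri≈ _ refl _ =
  ¬SumOf-offsets-2 (subst (SumOf offsets t) (sym (+-cancelˡ-≡ ((1 + k) * a) 2 s eq)) σ)
... | tri> _ _ 1+k<t = <-irrefl eq (too-many 1+k<t)
  where
  open ≤-Reasoning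
  too-many : 1 + k < t → (1 + k) * a + 2 < t * a + s
  too-many 1+k<t = begin-strict
    (1 + k) * a + 2  <⟨ +-monoʳ-< ((1 + k) * a) 3≤a ⟩
    (1 + k) * a + a  ≡⟨ +-comm ((1 + k) * a) a ⟩
    (2 + k) * a      ≤⟨ *-monoˡ-≤ a 1+k<t ⟩
    t * a            ≤⟨ m≤m+n (t * a) s ⟩
    t * a + s        ∎

representable-past-gap : u ≤ 2 + k * 5 →
                         Representable (map (a +_) offsets) (suc ((1 + k) * a + 2) + u)
representable-past-gap {u} {k} {a} u≤ =
  subst (Representable _) (regroup (1 + k) a u)
    (SumOf⇒Representable-shifted (SumOf-offsets-3+ k u u≤))
  where
  regroup : ∀ t a u → t * a + (3 + u) ≡ suc (t * a + 2) + u
  regroup = solve-∀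

corollary5 : (a : ℕ) → 3 ≤ a →
    IsFrobeniusNumber (a ∷ (a + 3) ∷ (a + 4) ∷ (a + 5) ∷ []) ((1 + (a + 1) / 5) * a + 2)
corollary5 a 3≤a = not-representable , representable-beyond {{nonZero}} (here refl) past-gap
  where
  nonZero : NonZero a
  nonZero = >-nonZero (≤-trans (s≤s z≤n) 3≤a)
  generators : List ℕ
  generators = a ∷ (a + 3) ∷ (a + 4) ∷ (a + 5) ∷ []
  shifted : map (a +_) offsets ≡ generators
  shifted = cong (_∷ (a + 3) ∷ (a + 4) ∷ (a + 5) ∷ []) (+-identityʳ a)

  not-representable : ¬ Representable generators ((1 + (a + 1) / 5) * a + 2)
  not-representable rep with Representable-shifted⇒SumOf (subst (flip Representable _) (sym shifted) rep)
  ... | t , s , σ , eq = frobenius-gap {k = (a + 1) / 5} 3≤a (m/n*n≤m (a + 1) 5) σ eq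

  past-gap : ∀ i → i < a → Representable generators (suc ((1 + (a + 1) / 5) * a + 2) + i)
  past-gap i i<a = subst (flip Representable _) shifted
    (representable-past-gap {k = (a + 1) / 5} (s≤s⁻¹ (≤-trans i<a (a≤3+[a+1]/5*5 a))))
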